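{- Let $e\ge2$ and let $\Delta$ be a pure simplicial complex with exactly two facets, each of cardinality $e$, with $f$-vector $(f_{ -1}=1,f_0,\dots,f_{e-2},f_{e-1}=2)$. Then for all $a=0,1,\dots,\lfloor e/2\rfloor-1$, $$f_{\lfloor e/2\rfloor-a-1}>f_{\lfloor (e+1)/2\rfloor+a}.$$
   Context: A simplicial complex is a family of subsets of a finite set closed under taking subsets; its maximal elements are facets, and it is pure if all facets have the same cardinality. $f_i$ denotes the number of faces of cardinality $i+1$. -}

module Defs where

open import Data.Nat using (ℕ; zero; suc; _≟_)
open import Data.Bool using (Bool; true; false)
open import Data.Vec using (Vec; []; _∷_)
open import Data.List using (List; []; _∷_; map; _++_; length; filter)
open import Data.Fin.Subset using (Subset; _⊆_; ∣_∣)
open import Data.Product using (_×_; ∃₂)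
open import Data.Sum using (_⊎_)
open import Relation.Binary.PropositionalEquality using (_≡_; _≢_)
open import Relation.Nullary using (¬_)
open import Relation.Nullary.Decidable using (_×-dec_)

allSubsets : (n : ℕ) → List (Subset n)
allSubsets zero    = [] ∷ []
allSubsets (suc n) = map (false ∷_) (allSubsets n) ++ map (true ∷_) (allSubsets n)

record SimplicialComplex (n : ℕ) : Set where
  field
    face     : Subset n → Bool
    downward : ∀ (S T : Subset n) → S ⊆ T → face T ≡ true → face S ≡ true
open SimplicialComplex public

IsFacet : ∀ {n} → SimplicialComplex n → Subset n → Set
IsFacet Δ F = (face Δ F ≡ true) × (∀ T → face Δ T ≡ true → F ⊆ T → T ≡ F)

PureTwoFacets : ∀ {n} → SimplicialComplex n → ℕ → Set
PureTwoFacets {n} Δ e =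
  ∃₂ λ (F G : Subset n) →
    (F ≢ G) × IsFacet Δ F × IsFacet Δ G × (∣ F ∣ ≡ e) × (∣ G ∣ ≡ e)
    × (∀ H → IsFacet Δ H → (H ≡ F) ⊎ (H ≡ G))

faceCount : ∀ {n} → SimplicialComplex n → ℕ → ℕ
faceCount {n} Δ k =
  length (filter (λ S → (∣ S ∣ ≟ k) ×-dec (face Δ S Data.Bool.≟ true)) (allSubsets n))

-- f_i = number of faces of cardinality i+1 (only used here for i ≥ 0).
fvec : ∀ {n} → SimplicialComplex n → ℕ → ℕ
fvec Δ i = faceCount Δ (suc i)

module Submission where

-- Let F and G be the two facets, |F| = |G| = e, and m = |F ∩ G|.
-- Every face extends to a facet, so the faces are exactly the subsets of F or
-- of G, and inclusion–exclusion gives, for every cardinality k,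
--     (number of faces of size k) + C(m,k) = 2·C(e,k).
-- The theorem compares the face numbers in cardinalities k < l with
-- k + l = e + 1.  For such k, l the row-e binomials satisfy C(e,l) < C(e,k),
-- and the difference j ↦ C(j,k) − C(j,l) is nondecreasing for j ≤ e; together
-- 2·C(e,l) + C(m,k) < 2·C(e,k) + C(m,l), which is the claimed inequality.

open import Defs
open import Data.Nat using (ℕ; zero; suc; _≤_; _<_; _>_; _+_; _∸_; _/_; z≤n; s≤s; _≡ᵇ_; ⌊_/2⌋)
open import Data.Nat.Properties
open import Data.Nat.DivMod using (m/n≡1+[m∸n]/n)
open import Data.Nat.Combinatorics using (_C_; k>n⇒nCk≡0; nCn≡1; nCk+nC[k+1]≡[n+1]C[k+1])
open import Algebra.Properties.CommutativeSemigroup +-commutativeSemigroup using (xy∙z≈xz∙y; x∙yz≈xz∙y; xy∙z≈x∙zy) renaming (interchange to +-interchange)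
open import Data.Bool using (Bool; true; false; _∧_; _∨_)
import Data.Bool as Bool
open import Data.Bool.Properties using (∧-zeroʳ; ∨-zeroʳ)
open import Data.List using (List; []; _∷_; map; _++_; length; filter)
open import Data.List.Membership.Propositional using (_∈_; lose)
open import Data.List.Relation.Unary.Any as Any using (here; any?; satisfied)
open import Data.List.Relation.Unary.Any.Properties using (++⁺ˡ; ++⁺ʳ; map⁺)
open import Data.Fin.Subset using (Subset; _⊆_; ∣_∣; _∩_)
open import Data.Fin.Subset.Properties
  using (_⊆?_; p⊆q⇒∣p∣≤∣q∣; ∣p∣≤n; drop-∷-⊆; p∩q⊆p; p∩q⊆q; x∈p∩q⁺; ∣p∩q∣≤∣p∣)
open import Data.Vec using ([]; _∷_)
import Data.Vec.Base as Vec
open import Data.Product using (∃; _×_; _,_; proj₁; proj₂)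
open import Data.Sum using (_⊎_; inj₁; inj₂)
open import Data.Empty using (⊥-elim)
open import Relation.Binary.PropositionalEquality
open import Relation.Nullary using (yes; no; does)
open import Relation.Nullary.Decidable using (_×-dec_)
open import Relation.Unary using (Decidable)
open import Function using (_∘_; id)

-- 1. Binomial coefficients

pascal : ∀ n k → suc n C suc k ≡ n C k + n C suc k
pascal n k = sym (nCk+nC[k+1]≡[n+1]C[k+1] n k)

C≤1 : ∀ {j b} → j ≤ b → j C b ≤ 1
C≤1 {j} j≤b with m≤n⇒m<n∨m≡n j≤b
... | inj₁ j<b  = ≤-trans (≤-reflexive (k>n⇒nCk≡0 j<b)) z≤n
... | inj₂ refl = ≤-reflexive (nCn≡1 j)

-- Row j is weakly decreasing away from its middle: if a ≤ b and a + b ≥ j,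
-- then b is at least as far from j/2 as a, so C(j,b) ≤ C(j,a).
C-antitone : ∀ j {a b} → a ≤ b → j ≤ a + b → j C b ≤ j C a
C-antitone j       {zero}  {b}     _ j≤b = C≤1 j≤b
C-antitone zero    {suc a} {suc b} _ _   = z≤n
C-antitone (suc j) {suc a} {suc b} (s≤s a≤b) (s≤s j≤a+1+b) with m≤n⇒m<n∨m≡n a≤b
... | inj₂ refl = ≤-refl
... | inj₁ a<b  = begin
  suc j C suc b       ≡⟨ pascal j b ⟩
  j C b + j C suc b   ≤⟨ +-mono-≤ (C-antitone j a<b (subst (j ≤_) (+-suc a b) j≤a+1+b))
                                  (C-antitone j (m≤n⇒m≤1+n a≤b) j≤a+1+b) ⟩
  j C suc a + j C a   ≡⟨ +-comm (j C suc a) (j C a) ⟩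
  j C a + j C suc a   ≡⟨ pascal j a ⟨
  suc j C suc a       ∎
  where open ≤-Reasoning

C-antitone-strict : ∀ j {a b} → a < b → j < a + b → a ≤ j → j C b < j C a
C-antitone-strict j       {zero}          _ j<b _ = s≤s (≤-reflexive (k>n⇒nCk≡0 j<b))
C-antitone-strict zero    {suc a}         _ _   ()
C-antitone-strict (suc j) {suc a} {suc b} (s≤s a<b) (s≤s j<a+1+b) (s≤s a≤j) = begin-strict
  suc j C suc b       ≡⟨ pascal j b ⟩
  j C b + j C suc b   <⟨ +-mono-≤-< (C-antitone j a<b (subst (j ≤_) (+-suc a b) (<⇒≤ j<a+1+b)))
                                    (C-antitone-strict j (m<n⇒m<1+n a<b) j<a+1+b a≤j) ⟩
  j C suc a + j C a   ≡⟨ +-comm (j C suc a) (j C a) ⟩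
  j C a + j C suc a   ≡⟨ pascal j a ⟨
  suc j C suc a       ∎
  where open ≤-Reasoning

-- One step of the monotonicity of j ↦ C(j,k) − C(j,l) (for k ≤ l), written
-- without subtraction: C(i+1,l) + C(i,k) ≤ C(i+1,k) + C(i,l) while i+1 < k+l.
C-gap-step : ∀ i {k l} → k ≤ l → suc i < k + l → suc i C l + i C k ≤ suc i C k + i C l
C-gap-step i {zero} {l} _ i+1<l
  rewrite k>n⇒nCk≡0 i+1<l | k>n⇒nCk≡0 (<-trans (n<1+n i) i+1<l) = ≤-refl
C-gap-step i {suc k} {suc l} (s≤s k≤l) (s≤s i+1<k+1+l) = begin
  suc i C suc l + i C suc k         ≡⟨ cong (_+ i C suc k) (pascal i l) ⟩
  (i C l + i C suc l) + i C suc k   ≤⟨ +-monoˡ-≤ (i C suc k) (+-monoˡ-≤ (i C suc l) (C-antitone i k≤l i≤k+l)) ⟩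
  (i C k + i C suc l) + i C suc k   ≡⟨ xy∙z≈xz∙y (i C k) (i C suc l) (i C suc k) ⟩
  (i C k + i C suc k) + i C suc l   ≡⟨ cong (_+ i C suc l) (pascal i k) ⟨
  suc i C suc k + i C suc l         ∎
  where
  open ≤-Reasoning
  i≤k+l : i ≤ k + l
  i≤k+l = ≤-pred (subst (suc i ≤_) (+-suc k l) i+1<k+1+l)

C-gap-mono : ∀ e {k l j} → k ≤ l → j ≤ e → e < k + l → e C l + j C k ≤ e C k + j C l
C-gap-mono e {k} {l} {j} k≤l j≤e e<k+l with m≤n⇒m<n∨m≡n j≤e
... | inj₂ refl = ≤-reflexive (+-comm (j C l) (j C k))
C-gap-mono zero    _ _ _ | inj₁ ()
C-gap-mono (suc e) {k} {l} {j} k≤l _ e+1<k+l | inj₁ (s≤s j≤e) =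
  +-cancelʳ-≤ (e C k) (suc e C l + j C k) (suc e C k + j C l) (begin
    (suc e C l + j C k) + e C k   ≡⟨ xy∙z≈xz∙y (suc e C l) (j C k) (e C k) ⟩
    (suc e C l + e C k) + j C k   ≤⟨ +-monoˡ-≤ (j C k) (C-gap-step e k≤l e+1<k+l) ⟩
    (suc e C k + e C l) + j C k   ≡⟨ +-assoc (suc e C k) (e C l) (j C k) ⟩
    suc e C k + (e C l + j C k)   ≤⟨ +-monoʳ-≤ (suc e C k) (C-gap-mono e k≤l j≤e (<-trans (n<1+n e) e+1<k+l)) ⟩
    suc e C k + (e C k + j C l)   ≡⟨ x∙yz≈xz∙y (suc e C k) (e C k) (j C l) ⟩
    (suc e C k + j C l) + e C k   ∎)
  where open ≤-Reasoning

two-simplices-binomial : ∀ {e m k l} → m ≤ e → k < l → k + l ≡ suc e →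
  (e C l + e C l) + m C k < (e C k + e C k) + m C l
two-simplices-binomial {e} {m} {k} {l} m≤e k<l k+l≡e+1 = begin-strict
  (e C l + e C l) + m C k   ≡⟨ +-assoc (e C l) (e C l) (m C k) ⟩
  e C l + (e C l + m C k)   <⟨ +-mono-<-≤ (C-antitone-strict e k<l e<k+l k≤e)
                                          (C-gap-mono e (<⇒≤ k<l) m≤e e<k+l) ⟩
  e C k + (e C k + m C l)   ≡⟨ +-assoc (e C k) (e C k) (m C l) ⟨
  (e C k + e C k) + m C l   ∎
  where
  open ≤-Reasoning
  e<k+l : e < k + l
  e<k+l = subst (e <_) (sym k+l≡e+1) (n<1+n e)
  k≤e : k ≤ e
  k≤e = ≤-pred (≤-trans k<l (subst (l ≤_) k+l≡e+1 (m≤n+m l k)))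

-- A sequence f with f(k) + C(m,k) = 2·C(e,k) for all k (the face numbers of
-- two e-sets glued along an m-set) decreases strictly from k to l = e+1−k.
glued-comparison : ∀ (f : ℕ → ℕ) {e m} → m ≤ e → (∀ k → f k + m C k ≡ e C k + e C k) →
  ∀ {k l} → k < l → k + l ≡ suc e → f l < f k
glued-comparison f {e} {m} m≤e count≡ {k} {l} k<l k+l≡e+1 =
  +-cancelʳ-< (m C l + m C k) (f l) (f k) (begin-strict
    f l + (m C l + m C k)     ≡⟨ +-assoc (f l) (m C l) (m C k) ⟨
    (f l + m C l) + m C k     ≡⟨ cong (_+ m C k) (count≡ l) ⟩
    (e C l + e C l) + m C k   <⟨ two-simplices-binomial m≤e k<l k+l≡e+1 ⟩
    (e C k + e C k) + m C l   ≡⟨ cong (_+ m C l) (count≡ k) ⟨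
    (f k + m C k) + m C l     ≡⟨ xy∙z≈x∙zy (f k) (m C k) (m C l) ⟩
    f k + (m C l + m C k)     ∎)
  where open ≤-Reasoning

-- 2. Counting

toℕ : Bool → ℕ
toℕ true  = 1
toℕ false = 0

count : {A : Set} → (A → Bool) → List A → ℕ
count p []       = 0
count p (x ∷ xs) = toℕ (p x) + count p xs

length-filter≡count : ∀ {A : Set} {P : A → Set} (P? : Decidable P) xs →
  length (filter P? xs) ≡ count (does ∘ P?) xs
length-filter≡count P? []       = refl
length-filter≡count P? (x ∷ xs) with does (P? x)
... | true  = cong suc (length-filter≡count P? xs)
... | false = length-filter≡count P? xs

count-cong : ∀ {A : Set} {p q : A → Bool} → (∀ x → p x ≡ q x) → ∀ xs → count p xs ≡ count q xs
count-cong p≗q []       = refl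
count-cong p≗q (x ∷ xs) = cong₂ _+_ (cong toℕ (p≗q x)) (count-cong p≗q xs)

count-++ : ∀ {A : Set} (p : A → Bool) xs ys → count p (xs ++ ys) ≡ count p xs + count p ys
count-++ p []       ys = refl
count-++ p (x ∷ xs) ys = trans (cong (toℕ (p x) +_) (count-++ p xs ys)) (sym (+-assoc (toℕ (p x)) _ _))

count-map : ∀ {A B : Set} (p : B → Bool) (h : A → B) xs → count p (map h xs) ≡ count (p ∘ h) xs
count-map p h []       = refl
count-map p h (x ∷ xs) = cong (toℕ (p (h x)) +_) (count-map p h xs)

count-false : ∀ {A : Set} xs → count {A} (λ _ → false) xs ≡ 0
count-false []       = refl
count-false (x ∷ xs) = count-false xs

inclusion–exclusion : ∀ {A : Set} (c a b : A → Bool) xs →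
  count (λ x → c x ∧ (a x ∨ b x)) xs + count (λ x → c x ∧ (a x ∧ b x)) xs
  ≡ count (λ x → c x ∧ a x) xs + count (λ x → c x ∧ b x) xs
inclusion–exclusion c a b []       = refl
inclusion–exclusion c a b (x ∷ xs) = begin
  (toℕ (c x ∧ (a x ∨ b x)) + ∪xs) + (toℕ (c x ∧ (a x ∧ b x)) + ∩xs)
    ≡⟨ +-interchange (toℕ (c x ∧ (a x ∨ b x))) ∪xs (toℕ (c x ∧ (a x ∧ b x))) ∩xs ⟩
  (toℕ (c x ∧ (a x ∨ b x)) + toℕ (c x ∧ (a x ∧ b x))) + (∪xs + ∩xs)
    ≡⟨ cong₂ _+_ (pointwise (c x) (a x) (b x)) (inclusion–exclusion c a b xs) ⟩
  (toℕ (c x ∧ a x) + toℕ (c x ∧ b x)) + (count (λ x → c x ∧ a x) xs + count (λ x → c x ∧ b x) xs)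
    ≡⟨ +-interchange (toℕ (c x ∧ a x)) (toℕ (c x ∧ b x)) _ _ ⟩
  (toℕ (c x ∧ a x) + count (λ x → c x ∧ a x) xs) + (toℕ (c x ∧ b x) + count (λ x → c x ∧ b x) xs) ∎
  where
  open ≡-Reasoning
  ∪xs ∩xs : ℕ
  ∪xs = count (λ x → c x ∧ (a x ∨ b x)) xs
  ∩xs = count (λ x → c x ∧ (a x ∧ b x)) xs
  pointwise : ∀ c a b → toℕ (c ∧ (a ∨ b)) + toℕ (c ∧ (a ∧ b)) ≡ toℕ (c ∧ a) + toℕ (c ∧ b)
  pointwise true  true  true  = refl
  pointwise true  true  false = refl
  pointwise true  false true  = refl
  pointwise true  false false = refl
  pointwise false a     b     = refl

-- 3. Subsets of Fin n

ofSize : ∀ {n} → ℕ → Subset n → Bool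
ofSize k S = ∣ S ∣ ≡ᵇ k

within : ∀ {n} → Subset n → Subset n → Bool
within F S = does (S ⊆? F)

within-complete : ∀ {n} {S F : Subset n} → S ⊆ F → within F S ≡ true
within-complete {S = S} {F} S⊆F with S ⊆? F
... | yes _    = refl
... | no  S⊈F = ⊥-elim (S⊈F S⊆F)

within-∩ : ∀ {n} (F G S : Subset n) → within F S ∧ within G S ≡ within (F ∩ G) S
within-∩ F G S with S ⊆? F | S ⊆? G | S ⊆? (F ∩ G)
... | yes _   | yes _   | yes _     = refl
... | yes S⊆F | yes S⊆G | no  S⊈F∩G = ⊥-elim (S⊈F∩G (λ x∈S → x∈p∩q⁺ (S⊆F x∈S , S⊆G x∈S)))
... | no  S⊈F | _       | yes S⊆F∩G = ⊥-elim (S⊈F (λ x∈S → p∩q⊆p F G (S⊆F∩G x∈S)))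
... | yes _   | no  S⊈G | yes S⊆F∩G = ⊥-elim (S⊈G (λ x∈S → p∩q⊆q F G (S⊆F∩G x∈S)))
... | yes _   | no  _   | no  _     = refl
... | no  _   | _       | no  _     = refl

allSubsets-complete : ∀ {n} (S : Subset n) → S ∈ allSubsets n
allSubsets-complete [] = here refl
allSubsets-complete {suc n} (false ∷ S) =
  ++⁺ˡ (map⁺ (Any.map (cong (false ∷_)) (allSubsets-complete S)))
allSubsets-complete {suc n} (true ∷ S) =
  ++⁺ʳ (map (false ∷_) (allSubsets n)) (map⁺ (Any.map (cong (true ∷_)) (allSubsets-complete S)))

count-allSubsets-suc : ∀ n (p : Subset (suc n) → Bool) →
  count p (allSubsets (suc n)) ≡ count (p ∘ (false ∷_)) (allSubsets n) + count (p ∘ (true ∷_)) (allSubsets n)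
count-allSubsets-suc n p = begin
  count p (map (false ∷_) Ss ++ map (true ∷_) Ss)          ≡⟨ count-++ p (map (false ∷_) Ss) (map (true ∷_) Ss) ⟩
  count p (map (false ∷_) Ss) + count p (map (true ∷_) Ss) ≡⟨ cong₂ _+_ (count-map p (false ∷_) Ss) (count-map p (true ∷_) Ss) ⟩
  count (p ∘ (false ∷_)) Ss + count (p ∘ (true ∷_)) Ss     ∎
  where
  open ≡-Reasoning
  Ss : List (Subset n)
  Ss = allSubsets n

k-subsets : ∀ {n} (F : Subset n) k → count (λ S → ofSize k S ∧ within F S) (allSubsets n) ≡ ∣ F ∣ C k
k-subsets []          zero    = refl
k-subsets []          (suc k) = refl
k-subsets {suc n} (false ∷ F) k = begin
  count (λ S → ofSize k S ∧ within (false ∷ F) S) (allSubsets (suc n))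
    ≡⟨ count-allSubsets-suc n (λ S → ofSize k S ∧ within (false ∷ F) S) ⟩
  count (λ S → ofSize k S ∧ within F S) Ss + count (λ S → ofSize k (true ∷ S) ∧ false) Ss
    ≡⟨ cong₂ _+_ (k-subsets F k) (trans (count-cong (λ S → ∧-zeroʳ (ofSize k (true ∷ S))) Ss) (count-false Ss)) ⟩
  ∣ F ∣ C k + 0
    ≡⟨ +-identityʳ (∣ F ∣ C k) ⟩
  ∣ F ∣ C k ∎
  where
  open ≡-Reasoning
  Ss : List (Subset n)
  Ss = allSubsets n
k-subsets {suc n} (true ∷ F) zero =
  trans (count-allSubsets-suc n (λ S → ofSize zero S ∧ within (true ∷ F) S))
        (cong₂ _+_ (k-subsets F zero) (count-false (allSubsets n)))
k-subsets {suc n} (true ∷ F) (suc k) = begin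
  count (λ S → ofSize (suc k) S ∧ within (true ∷ F) S) (allSubsets (suc n))
    ≡⟨ count-allSubsets-suc n (λ S → ofSize (suc k) S ∧ within (true ∷ F) S) ⟩
  count (λ S → ofSize (suc k) S ∧ within F S) Ss + count (λ S → ofSize k S ∧ within F S) Ss
    ≡⟨ cong₂ _+_ (k-subsets F (suc k)) (k-subsets F k) ⟩
  ∣ F ∣ C suc k + ∣ F ∣ C k
    ≡⟨ +-comm (∣ F ∣ C suc k) (∣ F ∣ C k) ⟩
  ∣ F ∣ C k + ∣ F ∣ C suc k
    ≡⟨ pascal ∣ F ∣ k ⟨
  suc ∣ F ∣ C suc k ∎
  where
  open ≡-Reasoning
  Ss : List (Subset n)
  Ss = allSubsets n

⊆-card-≡ : ∀ {n} {S T : Subset n} → S ⊆ T → ∣ T ∣ ≤ ∣ S ∣ → T ≡ S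
⊆-card-≡ {S = []}        {[]}        _   _  = refl
⊆-card-≡ {S = false ∷ S} {false ∷ T} S⊆T le = cong (false ∷_) (⊆-card-≡ (drop-∷-⊆ S⊆T) le)
⊆-card-≡ {S = false ∷ S} {true ∷ T}  S⊆T le =
  ⊥-elim (<-irrefl refl (≤-trans le (p⊆q⇒∣p∣≤∣q∣ (drop-∷-⊆ S⊆T))))
⊆-card-≡ {S = true ∷ S}  {false ∷ T} S⊆T _ with S⊆T Vec.here
... | ()
⊆-card-≡ {S = true ∷ S}  {true ∷ T}  S⊆T (s≤s le) = cong (true ∷_) (⊆-card-≡ (drop-∷-⊆ S⊆T) le)

-- 4. Simplicial complexes with two facets

module _ {n : ℕ} (Δ : SimplicialComplex n) where

  StrictlyAbove : Subset n → Subset n → Set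
  StrictlyAbove S T = (face Δ T ≡ true) × (S ⊆ T) × (∣ S ∣ < ∣ T ∣)

  strictlyAbove? : ∀ S → Decidable (StrictlyAbove S)
  strictlyAbove? S T = (face Δ T Bool.≟ true) ×-dec ((S ⊆? T) ×-dec (∣ S ∣ <? ∣ T ∣))

  -- Every face lies in a facet: climb to strictly larger faces while one
  -- exists.  The fuel d bounds how far the cardinality can still grow.
  extend-to-facet : ∀ S → face Δ S ≡ true → ∃ λ T → S ⊆ T × IsFacet Δ T
  extend-to-facet S S∈Δ = climb n S (m≤m+n n ∣ S ∣) S∈Δ
    where
    climb : ∀ d S → n ≤ d + ∣ S ∣ → face Δ S ≡ true → ∃ λ T → S ⊆ T × IsFacet Δ T
    climb-from : ∀ d {S} → ∃ (StrictlyAbove S) → n ≤ d + ∣ S ∣ → ∃ λ T → S ⊆ T × IsFacet Δ T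

    climb d S n≤d+∣S∣ S∈Δ with any? (strictlyAbove? S) (allSubsets n)
    ... | yes above        = climb-from d (satisfied above) n≤d+∣S∣
    ... | no nothing-above = S , id , S∈Δ , λ T T∈Δ S⊆T →
      ⊆-card-≡ S⊆T (≮⇒≥ λ ∣S∣<∣T∣ → nothing-above (lose (allSubsets-complete T) (T∈Δ , S⊆T , ∣S∣<∣T∣)))

    -- with no fuel left, S already has n elements and nothing is larger
    climb-from zero    (T , _ , _ , ∣S∣<∣T∣) n≤∣S∣ =
      ⊥-elim (<-irrefl refl (≤-trans ∣S∣<∣T∣ (≤-trans (∣p∣≤n T) n≤∣S∣)))
    climb-from (suc d) {S} (T , T∈Δ , S⊆T , ∣S∣<∣T∣) n≤1+d+∣S∣
      with climb d T (≤-trans n≤1+d+∣S∣ (subst (_≤ d + ∣ T ∣) (+-suc d ∣ S ∣) (+-monoʳ-≤ d ∣S∣<∣T∣))) T∈Δ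
    ... | U , T⊆U , U-facet = U , (λ x∈S → T⊆U (S⊆T x∈S)) , U-facet

  module TwoFacets (F G : Subset n) (F-facet : IsFacet Δ F) (G-facet : IsFacet Δ G)
                   (only-F-G : ∀ H → IsFacet Δ H → (H ≡ F) ⊎ (H ≡ G)) where

    face≡within : ∀ S → does (face Δ S Bool.≟ true) ≡ within F S ∨ within G S
    face≡within S with face Δ S in S∈Δ
    ... | true with extend-to-facet S S∈Δ
    ...   | T , S⊆T , T-facet with only-F-G T T-facet
    ...     | inj₁ refl = sym (cong (_∨ within G S) (within-complete S⊆T))
    ...     | inj₂ refl = sym (trans (cong (within F S ∨_) (within-complete S⊆T)) (∨-zeroʳ _))
    face≡within S | false = sym (cong₂ _∨_ (not-within F-facet) (not-within G-facet))
      where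
      not-within : ∀ {H} → IsFacet Δ H → within H S ≡ false
      not-within {H} (H∈Δ , _) with S ⊆? H
      ... | no _    = refl
      ... | yes S⊆H with trans (sym (downward Δ S H S⊆H H∈Δ)) S∈Δ
      ...   | ()

    faceCount-identity : ∀ k → faceCount Δ k + ∣ F ∩ G ∣ C k ≡ ∣ F ∣ C k + ∣ G ∣ C k
    faceCount-identity k = begin
      faceCount Δ k + ∣ F ∩ G ∣ C k
        ≡⟨ cong₂ _+_ faces-as-union intersection ⟩
      count (λ S → ofSize k S ∧ (within F S ∨ within G S)) Ss + count (λ S → ofSize k S ∧ (within F S ∧ within G S)) Ss
        ≡⟨ inclusion–exclusion (ofSize k) (within F) (within G) Ss ⟩
      count (λ S → ofSize k S ∧ within F S) Ss + count (λ S → ofSize k S ∧ within G S) Ss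
        ≡⟨ cong₂ _+_ (k-subsets F k) (k-subsets G k) ⟩
      ∣ F ∣ C k + ∣ G ∣ C k ∎
      where
      open ≡-Reasoning
      Ss : List (Subset n)
      Ss = allSubsets n
      faces-as-union : faceCount Δ k ≡ count (λ S → ofSize k S ∧ (within F S ∨ within G S)) Ss
      faces-as-union = trans (length-filter≡count _ Ss) (count-cong (λ S → cong (ofSize k S ∧_) (face≡within S)) Ss)
      intersection : ∣ F ∩ G ∣ C k ≡ count (λ S → ofSize k S ∧ (within F S ∧ within G S)) Ss
      intersection = sym (trans (count-cong (λ S → cong (ofSize k S ∧_) (within-∩ F G S)) Ss) (k-subsets (F ∩ G) k))

-- 5. Index arithmetic

/2≡⌊/2⌋ : ∀ n → n / 2 ≡ ⌊ n /2⌋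
/2≡⌊/2⌋ zero          = refl
/2≡⌊/2⌋ (suc zero)    = refl
/2≡⌊/2⌋ (suc (suc n)) = trans (m/n≡1+[m∸n]/n {suc (suc n)} {2} (s≤s (s≤s z≤n))) (cong suc (/2≡⌊/2⌋ n))

halves : ∀ e → (e / 2 + (e + 1) / 2 ≡ e) × (e / 2 ≤ (e + 1) / 2)
halves e rewrite /2≡⌊/2⌋ e | /2≡⌊/2⌋ (e + 1) | +-comm e 1 = ⌊n/2⌋+⌈n/2⌉≡n e , ⌊n/2⌋≤⌈n/2⌉ e

suc[m∸n∸1]+n≡m : ∀ {m n} → n < m → suc (m ∸ n ∸ 1) + n ≡ m
suc[m∸n∸1]+n≡m {suc m} {zero}  _         = +-identityʳ (suc m)
suc[m∸n∸1]+n≡m {suc m} {suc n} (s≤s n<m) = trans (+-suc (suc (m ∸ n ∸ 1)) n) (cong suc (suc[m∸n∸1]+n≡m n<m))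

mirrored-indices : ∀ {h h' a e} → h + h' ≡ e → h ≤ h' → a < h →
  (suc (h ∸ a ∸ 1) + suc (h' + a) ≡ suc e) × (suc (h ∸ a ∸ 1) < suc (h' + a))
mirrored-indices {h} {h'} {a} {e} h+h'≡e h≤h' a<h = sum≡ , s≤s k≤h'+a
  where
  k : ℕ
  k = suc (h ∸ a ∸ 1)
  k+a≡h : k + a ≡ h
  k+a≡h = suc[m∸n∸1]+n≡m a<h
  sum≡ : k + suc (h' + a) ≡ suc e
  sum≡ = begin
    k + suc (h' + a)   ≡⟨ +-suc k (h' + a) ⟩
    suc (k + (h' + a)) ≡⟨ cong (λ x → suc (k + x)) (+-comm h' a) ⟩
    suc (k + (a + h')) ≡⟨ cong suc (+-assoc k a h') ⟨
    suc (k + a + h')   ≡⟨ cong (λ x → suc (x + h')) k+a≡h ⟩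
    suc (h + h')       ≡⟨ cong suc h+h'≡e ⟩
    suc e              ∎
    where open ≡-Reasoning
  k≤h'+a : k ≤ h' + a
  k≤h'+a = ≤-trans (subst (k ≤_) k+a≡h (m≤m+n k a)) (≤-trans h≤h' (m≤m+n h' a))

-- The face numbers f_i with i = ⌊e/2⌋ − a − 1 and i' = ⌊(e+1)/2⌋ + a sit at
-- cardinalities k = i + 1 and l = i' + 1 with k < l and k + l = e + 1.
proposition8p4 : ∀ (n e : ℕ) (Δ : SimplicialComplex n) → 2 ≤ e → PureTwoFacets Δ e →
    ∀ (a : ℕ) → a < e / 2 →
      fvec Δ (e / 2 ∸ a ∸ 1) > fvec Δ ((e + 1) / 2 + a)
proposition8p4 n e Δ _ (F , G , _ , F-facet , G-facet , ∣F∣≡e , ∣G∣≡e , only-F-G) a a<e/2 =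
  glued-comparison (faceCount Δ) ∣F∩G∣≤e face-numbers k<l k+l≡e+1
  where
  open TwoFacets Δ F G F-facet G-facet only-F-G
  face-numbers : ∀ k → faceCount Δ k + ∣ F ∩ G ∣ C k ≡ e C k + e C k
  face-numbers k = trans (faceCount-identity k) (cong₂ (λ x y → x C k + y C k) ∣F∣≡e ∣G∣≡e)
  ∣F∩G∣≤e : ∣ F ∩ G ∣ ≤ e
  ∣F∩G∣≤e = subst (∣ F ∩ G ∣ ≤_) ∣F∣≡e (∣p∩q∣≤∣p∣ F G)
  k+l≡e+1 : suc (e / 2 ∸ a ∸ 1) + suc ((e + 1) / 2 + a) ≡ suc e
  k+l≡e+1 = proj₁ (mirrored-indices (proj₁ (halves e)) (proj₂ (halves e)) a<e/2)
  k<l : suc (e / 2 ∸ a ∸ 1) < suc ((e + 1) / 2 + a)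
  k<l = proj₂ (mirrored-indices (proj₁ (halves e)) (proj₂ (halves e)) a<e/2)
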